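{- Let $G_1,\dots,G_n$ be graphs and let $f$ be an IASI of their join $\sum_{i=1}^{n}G_i$ whose restriction to each $G_i$ is a weak IASI. Then $f$ is a weak IASI of $\sum_{i=1}^{n}G_i$ if and only if there is an index $i_0$ such that $G_i$ is $1$-uniform under $f$ for every $i\neq i_0$.
   Context: All graphs are finite, simple and have no isolated vertices. $\mathbb{N}_0$ denotes the non-negative integers; for $A,B\subseteq\mathbb{N}_0$, $A+B=\{a+b:a\in A,b\in B\}$. An integer additive set-indexer (IASI) of a graph $G$ is an injective map $f:V(G)\to 2^{\mathbb{N}_0}$ such that $g_f:E(G)\to 2^{\mathbb{N}_0}$, $g_f(uv)=f(u)+f(v)$, is injective. A subgraph is $1$-uniform under $f$ if $|g_f(e)|=1$ for all its edges $e$. $f$ is a weak IASI if $|g_f(uv)|=\max(|f(u)|,|f(v)|)$ for every edge $uv$. The join of vertex-disjoint graphs $G_1,\dots,G_n$ has vertex set $\bigcup V_i$ and edge set $\bigcup E_i$ together with all edges $uv$ with $u\in V_i$, $v\in V_j$, $i\neq j$. -}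

module Defs where

open import Level using (0ℓ)
open import Data.Nat using (ℕ; _+_; _⊔_; _≟_)
open import Data.Fin using (Fin)
open import Data.List using (List; length; deduplicate; cartesianProductWith)
open import Data.List.Membership.Propositional using (_∈_)
open import Data.Product using (Σ; ∃; _×_; _,_)
open import Data.Sum using (_⊎_)
open import Function.Bundles using (_⇔_)
open import Relation.Binary.PropositionalEquality using (_≡_; _≢_)
open import Relation.Nullary using (¬_)

-- Finite sets of non-negative integers, represented by a list of their
-- elements (duplicates allowed; order irrelevant).
FinSetℕ : Set
FinSetℕ = List ℕ

_≐_ : FinSetℕ → FinSetℕ → Set
A ≐ B = ∀ x → (x ∈ A) ⇔ (x ∈ B)

card : FinSetℕ → ℕ
card A = length (deduplicate _≟_ A)

_⊕_ : FinSetℕ → FinSetℕ → FinSetℕ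
A ⊕ B = cartesianProductWith _+_ A B

record Graph : Set₁ where
  field
    size       : ℕ
    Adj        : Fin size → Fin size → Set
    sym        : ∀ {u v} → Adj u v → Adj v u
    irrefl     : ∀ {u} → ¬ Adj u u
    noIsolated : ∀ u → ∃ λ v → Adj u v
open Graph public

IsIASI : {V : Set} → (V → V → Set) → (V → FinSetℕ) → Set
IsIASI {V} E f =
  (∀ u v → f u ≐ f v → u ≡ v) ×
  (∀ u v x y → E u v → E x y → (f u ⊕ f v) ≐ (f x ⊕ f y) →
     (u ≡ x × v ≡ y) ⊎ (u ≡ y × v ≡ x))

IsWeak : {V : Set} → (V → V → Set) → (V → FinSetℕ) → Set
IsWeak E f = ∀ u v → E u v → card (f u ⊕ f v) ≡ card (f u) ⊔ card (f v)

IsWeakIASI : {V : Set} → (V → V → Set) → (V → FinSetℕ) → Set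
IsWeakIASI E f = IsIASI E f × IsWeak E f

IsOneUniform : {V : Set} → (V → V → Set) → (V → FinSetℕ) → Set
IsOneUniform E f = ∀ u v → E u v → card (f u ⊕ f v) ≡ 1

JoinV : {n : ℕ} → (Fin n → Graph) → Set
JoinV {n} G = Σ (Fin n) (λ i → Fin (size (G i)))

JoinAdj : {n : ℕ} (G : Fin n → Graph) → JoinV G → JoinV G → Set
JoinAdj G (i , u) (j , v) =
  (Σ (i ≡ j) λ { _≡_.refl → Adj (G i) u v }) ⊎ (i ≢ j)

restrict : {n : ℕ} (G : Fin n → Graph) → (JoinV G → FinSetℕ) →
           (i : Fin n) → Fin (size (G i)) → FinSetℕ
restrict G f i v = f (i , v)

-- For nonempty A, B ⊆ ℕ with |B| ≥ 2, the sums a + min B (a ∈ A) together with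
-- max A + max B are |A| + 1 distinct elements of A + B; hence
-- |A + B| = max(|A|, |B|) holds exactly when A or B is a singleton.  A weak IASI
-- of a graph without isolated vertices has nonempty labels, and a part is then
-- 1-uniform iff all its labels are singletons.  In the join any two vertices of
-- different parts are adjacent, so the join is weak iff no two parts both carry
-- a non-singleton label.
module Submission where

open import Defs hiding (sym)
open import Data.Nat using (ℕ; suc; _+_; _⊔_; _≤_; _<_; _≟_; _<?_; z≤n; s≤s)
open import Data.Nat.Properties
open import Data.Fin using (Fin) renaming (zero to fzero)
open import Data.Fin.Properties using (any?) renaming (_≟_ to _≟ᶠ_)
open import Data.List using (List; []; _∷_; length; map; deduplicate)
open import Data.List.Properties using (length-map; length-removeAt′)
open import Data.List.Membership.Propositional using (_∈_; _∉_; _─_; find; lose)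
open import Data.List.Membership.Propositional.Properties
  using (∈-map⁺; ∈-map⁻; ∈-cartesianProductWith⁺; ∈-cartesianProductWith⁻; ∈-deduplicate⁺; ∈-deduplicate⁻)
open import Data.List.Relation.Binary.Subset.Propositional using (_⊆_)
open import Data.List.Relation.Unary.Any as Any using (here; there; index)
open import Data.List.Relation.Unary.All as All using ([]; _∷_)
open import Data.List.Relation.Unary.AllPairs using ([]; _∷_)
open import Data.List.Relation.Unary.Unique.Propositional using (Unique)
open import Data.List.Relation.Unary.Unique.Propositional.Properties using (map⁺)
open import Data.List.Relation.Unary.Unique.DecPropositional.Properties using (deduplicate-!)
open import Data.Product using (Σ; ∃; ∃₂; _×_; _,_; proj₁; proj₂)
open import Data.Sum using (_⊎_; inj₁; inj₂; [_,_])
open import Data.Empty using (⊥-elim)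
open import Function using (_∘_)
open import Function.Bundles using (_⇔_; mk⇔; Equivalence)
open import Relation.Nullary using (Dec; yes; no; ¬?; contradiction)
open import Relation.Nullary.Decidable using (decidable-stable)
open import Relation.Binary.PropositionalEquality using (_≡_; _≢_; refl; sym; trans; cong; subst)

open Equivalence using (to; from)

∈-─⁺ : ∀ {A : Set} {x z : A} {ys : List A} (x∈ys : x ∈ ys) → z ∈ ys → z ≢ x → z ∈ ys ─ x∈ys
∈-─⁺ (here refl) (here refl) z≢x = ⊥-elim (z≢x refl)
∈-─⁺ (here refl) (there z∈ys) _  = z∈ys
∈-─⁺ (there _)   (here z≡y)   _  = here z≡y
∈-─⁺ (there x∈ys) (there z∈ys) z≢x = there (∈-─⁺ x∈ys z∈ys z≢x)

unique-⊆⇒length≤ : ∀ {A : Set} {xs ys : List A} → Unique xs → xs ⊆ ys → length xs ≤ length ys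
unique-⊆⇒length≤ {xs = []} _ _ = z≤n
unique-⊆⇒length≤ {xs = x ∷ xs} {ys} (x∉xs ∷ xs!) xs⊆ys = begin
  suc (length xs)          ≤⟨ s≤s (unique-⊆⇒length≤ xs! xs⊆ys─x) ⟩
  suc (length (ys ─ x∈ys)) ≡⟨ sym (length-removeAt′ ys (index x∈ys)) ⟩
  length ys                ∎
  where
  open ≤-Reasoning
  x∈ys = xs⊆ys (here refl)
  xs⊆ys─x : xs ⊆ ys ─ x∈ys
  xs⊆ys─x z∈xs = ∈-─⁺ x∈ys (xs⊆ys (there z∈xs)) λ { refl → All.lookup x∉xs z∈xs refl }

length≤card : ∀ {L} A → Unique L → L ⊆ A → length L ≤ card A
length≤card A L! L⊆A = unique-⊆⇒length≤ L! (∈-deduplicate⁺ _≟_ ∘ L⊆A)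

card≤length : ∀ A L → A ⊆ L → card A ≤ length L
card≤length A L A⊆L = unique-⊆⇒length≤ (deduplicate-! _≟_ A) (A⊆L ∘ ∈-deduplicate⁻ _≟_ A)

card-mono : ∀ A B → A ⊆ B → card A ≤ card B
card-mono A B A⊆B = length≤card B (deduplicate-! _≟_ A) (A⊆B ∘ ∈-deduplicate⁻ _≟_ A)

card≡0⇒∉ : ∀ A → card A ≡ 0 → ∀ {x} → x ∉ A
card≡0⇒∉ A |A|≡0 x∈A with subst (1 ≤_) |A|≡0 (length≤card A ([] ∷ []) λ { (here refl) → x∈A })
... | ()

card≥1⇒∃∈ : ∀ A → 1 ≤ card A → ∃ λ a → a ∈ A
card≥1⇒∃∈ A 1≤|A| with deduplicate _≟_ A in eq
... | a ∷ _ = a , ∈-deduplicate⁻ _≟_ A (subst (a ∈_) (sym eq) (here refl))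

card≡1⇒singleton : ∀ A → card A ≡ 1 → ∃ λ a → a ∈ A × (∀ {x} → x ∈ A → x ≡ a)
card≡1⇒singleton A |A|≡1 with card≥1⇒∃∈ A (≤-reflexive (sym |A|≡1))
... | a , a∈A = a , a∈A , λ {x} x∈A → decidable-stable (x ≟ a) λ x≢a →
  <-irrefl (sym |A|≡1) (length≤card A ((x≢a ∷ []) ∷ [] ∷ [])
                    λ { (here refl) → x∈A ; (there (here refl)) → a∈A })

∃-maximum : ∀ {a} (A : List ℕ) → a ∈ A → ∃ λ m → m ∈ A × (∀ {x} → x ∈ A → x ≤ m)
∃-maximum (b ∷ []) _ = b , here refl , λ { (here refl) → ≤-refl }
∃-maximum (b ∷ c ∷ A) _ with ∃-maximum (c ∷ A) (here refl)
... | m , m∈ , ≤m with b ≤? m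
...   | yes b≤m = m , there m∈ , λ { (here refl) → b≤m ; (there x∈) → ≤m x∈ }
...   | no b≰m  = b , here refl , λ { (here refl) → ≤-refl ; (there x∈) → ≤-trans (≤m x∈) (<⇒≤ (≰⇒> b≰m)) }

card≥2⇒∃< : ∀ A → 2 ≤ card A → ∃₂ λ lo hi → lo ∈ A × hi ∈ A × lo < hi
card≥2⇒∃< A 2≤|A| with card≥1⇒∃∈ A (≤-trans (s≤s z≤n) 2≤|A|)
... | a , a∈A with ∃-maximum A a∈A
... | m , m∈A , ≤m with Any.any? (_<? m) A
...   | yes below = let lo , lo∈A , lo<m = find below in lo , m , lo∈A , m∈A , lo<m
...   | no ¬below = contradiction (card≤length A (m ∷ []) A⊆[m]) (<⇒≱ 2≤|A|)
  where
  A⊆[m] : A ⊆ m ∷ []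
  A⊆[m] x∈A = here (≤-antisym (≤m x∈A) (≮⇒≥ (¬below ∘ lose x∈A)))

∈-⊕⁺ : ∀ {A B a b} → a ∈ A → b ∈ B → a + b ∈ A ⊕ B
∈-⊕⁺ = ∈-cartesianProductWith⁺ _+_

∈-⊕⁻ : ∀ A B {z} → z ∈ A ⊕ B → ∃₂ λ a b → a ∈ A × b ∈ B × z ≡ a + b
∈-⊕⁻ = ∈-cartesianProductWith⁻ _+_

card-⊕-emptyˡ : ∀ A B → card A ≡ 0 → card (A ⊕ B) ≡ 0
card-⊕-emptyˡ A B |A|≡0 = n≤0⇒n≡0 (card≤length (A ⊕ B) [] A⊕B⊆[])
  where
  A⊕B⊆[] : A ⊕ B ⊆ []
  A⊕B⊆[] z∈ with ∈-⊕⁻ A B z∈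
  ... | _ , _ , a∈A , _ = ⊥-elim (card≡0⇒∉ A |A|≡0 a∈A)

⊕-comm-⊆ : ∀ A B → A ⊕ B ⊆ B ⊕ A
⊕-comm-⊆ A B z∈ with ∈-⊕⁻ A B z∈
... | a , b , a∈A , b∈B , refl = subst (_∈ B ⊕ A) (+-comm b a) (∈-⊕⁺ b∈B a∈A)

card-⊕-comm : ∀ A B → card (A ⊕ B) ≡ card (B ⊕ A)
card-⊕-comm A B = ≤-antisym (card-mono _ _ (⊕-comm-⊆ A B)) (card-mono _ _ (⊕-comm-⊆ B A))

-- The translate A + b as a duplicate-free list, so that its length is card A.
_+ᶜ_ : FinSetℕ → ℕ → FinSetℕ
A +ᶜ b = map (_+ b) (deduplicate _≟_ A)

length-+ᶜ : ∀ A b → length (A +ᶜ b) ≡ card A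
length-+ᶜ A b = length-map (_+ b) (deduplicate _≟_ A)

+ᶜ-unique : ∀ A b → Unique (A +ᶜ b)
+ᶜ-unique A b = map⁺ (+-cancelʳ-≡ b _ _) (deduplicate-! _≟_ A)

∈-+ᶜ⁺ : ∀ {A a} b → a ∈ A → a + b ∈ A +ᶜ b
∈-+ᶜ⁺ b a∈A = ∈-map⁺ (_+ b) (∈-deduplicate⁺ _≟_ a∈A)

∈-+ᶜ⁻ : ∀ A b {z} → z ∈ A +ᶜ b → ∃ λ a → a ∈ A × z ≡ a + b
∈-+ᶜ⁻ A b z∈ with ∈-map⁻ (_+ b) z∈
... | a , a∈ , z≡a+b = a , ∈-deduplicate⁻ _≟_ A a∈ , z≡a+b

+ᶜ-⊆-⊕ : ∀ A {B b} → b ∈ B → A +ᶜ b ⊆ A ⊕ B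
+ᶜ-⊆-⊕ A {b = b} b∈B z∈ with ∈-+ᶜ⁻ A b z∈
... | a , a∈A , refl = ∈-⊕⁺ a∈A b∈B

card≤card-⊕ : ∀ A B → 1 ≤ card B → card A ≤ card (A ⊕ B)
card≤card-⊕ A B 1≤|B| with card≥1⇒∃∈ B 1≤|B|
... | b , b∈B = subst (_≤ card (A ⊕ B)) (length-+ᶜ A b)
                  (length≤card (A ⊕ B) (+ᶜ-unique A b) (+ᶜ-⊆-⊕ A b∈B))

card<card-⊕ : ∀ A B → 1 ≤ card A → 2 ≤ card B → card A < card (A ⊕ B)
card<card-⊕ A B 1≤|A| 2≤|B| with card≥1⇒∃∈ A 1≤|A| | card≥2⇒∃< B 2≤|B|
... | a , a∈A | lo , hi , lo∈B , hi∈B , lo<hi with ∃-maximum A a∈A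
... | m , m∈A , ≤m = subst (_≤ card (A ⊕ B)) (cong suc (length-+ᶜ A lo))
                       (length≤card (A ⊕ B) (top∉ ∷ +ᶜ-unique A lo) sums⊆A⊕B)
  where
  top∉ : All.All (m + hi ≢_) (A +ᶜ lo)
  top∉ = All.tabulate λ z∈ → case∈ (∈-+ᶜ⁻ A lo z∈)
    where
    case∈ : ∀ {z} → ∃ (λ a → a ∈ A × z ≡ a + lo) → m + hi ≢ z
    case∈ (a , a∈A , refl) = >⇒≢ (+-mono-≤-< (≤m a∈A) lo<hi)
  sums⊆A⊕B : m + hi ∷ A +ᶜ lo ⊆ A ⊕ B
  sums⊆A⊕B (here refl) = ∈-⊕⁺ m∈A hi∈B
  sums⊆A⊕B (there z∈)  = +ᶜ-⊆-⊕ A lo∈B z∈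

card-⊕-singletonʳ : ∀ A B → card B ≡ 1 → card (A ⊕ B) ≡ card A
card-⊕-singletonʳ A B |B|≡1 with card≡1⇒singleton B |B|≡1
... | b , b∈B , ≡b = ≤-antisym
  (subst (card (A ⊕ B) ≤_) (length-+ᶜ A b) (card≤length (A ⊕ B) (A +ᶜ b) A⊕B⊆A+b))
  (card≤card-⊕ A B (≤-reflexive (sym |B|≡1)))
  where
  A⊕B⊆A+b : A ⊕ B ⊆ A +ᶜ b
  A⊕B⊆A+b z∈ with ∈-⊕⁻ A B z∈
  ... | a , b′ , a∈A , b′∈B , refl rewrite ≡b b′∈B = ∈-+ᶜ⁺ b a∈A

card-⊕-singletonˡ : ∀ A B → card A ≡ 1 → card (A ⊕ B) ≡ card B
card-⊕-singletonˡ A B |A|≡1 = trans (card-⊕-comm A B) (card-⊕-singletonʳ B A |A|≡1)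

⊔<card-⊕ : ∀ A B → 2 ≤ card A → 2 ≤ card B → card A ⊔ card B < card (A ⊕ B)
⊔<card-⊕ A B 2≤|A| 2≤|B| = ⊔-lub
  (card<card-⊕ A B (<⇒≤ 2≤|A|) 2≤|B|)
  (subst (card B <_) (card-⊕-comm B A) (card<card-⊕ B A (<⇒≤ 2≤|B|) 2≤|A|))

card-⊕≡⊔⇔singleton : ∀ A B → 1 ≤ card A → 1 ≤ card B →
  card (A ⊕ B) ≡ card A ⊔ card B ⇔ (card A ≡ 1 ⊎ card B ≡ 1)
card-⊕≡⊔⇔singleton A B 1≤|A| 1≤|B| = mk⇔ ⊔⇒singleton singleton⇒⊔
  where
  ⊔⇒singleton : card (A ⊕ B) ≡ card A ⊔ card B → card A ≡ 1 ⊎ card B ≡ 1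
  ⊔⇒singleton eq with card A ≟ 1 | card B ≟ 1
  ... | yes |A|≡1 | _         = inj₁ |A|≡1
  ... | no _      | yes |B|≡1 = inj₂ |B|≡1
  ... | no |A|≢1  | no |B|≢1  = contradiction eq (>⇒≢
          (⊔<card-⊕ A B (≤∧≢⇒< 1≤|A| (|A|≢1 ∘ sym)) (≤∧≢⇒< 1≤|B| (|B|≢1 ∘ sym))))
  singleton⇒⊔ : card A ≡ 1 ⊎ card B ≡ 1 → card (A ⊕ B) ≡ card A ⊔ card B
  singleton⇒⊔ (inj₁ |A|≡1) = trans (card-⊕-singletonˡ A B |A|≡1)
    (sym (trans (cong (_⊔ card B) |A|≡1) (m≤n⇒m⊔n≡n 1≤|B|)))
  singleton⇒⊔ (inj₂ |B|≡1) = trans (card-⊕-singletonʳ A B |B|≡1)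
    (sym (trans (cong (card A ⊔_) |B|≡1) (m≥n⇒m⊔n≡m 1≤|A|)))

weakIASI⇒card≥1 : (G : Graph) (f : Fin (size G) → FinSetℕ) →
  IsWeakIASI (Adj G) f → ∀ v → 1 ≤ card (f v)
weakIASI⇒card≥1 G f ((f-inj , _) , weak) v =
  n≢0⇒n>0 λ |fv|≡0 → irrefl G (subst (Adj G v) (sym (v≡w |fv|≡0)) v~w)
  where
  w = proj₁ (noIsolated G v)
  v~w = proj₂ (noIsolated G v)
  v≡w : card (f v) ≡ 0 → v ≡ w
  v≡w |fv|≡0 = f-inj v w λ x → mk⇔ (⊥-elim ∘ card≡0⇒∉ (f v) |fv|≡0) (⊥-elim ∘ card≡0⇒∉ (f w) |fw|≡0)
    where
    |fw|≡0 : card (f w) ≡ 0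
    |fw|≡0 = trans (sym (trans (weak v w v~w) (cong (_⊔ card (f w)) |fv|≡0))) (card-⊕-emptyˡ (f v) (f w) |fv|≡0)

oneUniform⇔singletons : (G : Graph) (f : Fin (size G) → FinSetℕ) → IsWeakIASI (Adj G) f →
  IsOneUniform (Adj G) f ⇔ (∀ v → card (f v) ≡ 1)
oneUniform⇔singletons G f f-weak = mk⇔ uniform⇒singletons singletons⇒uniform
  where
  uniform⇒singletons : IsOneUniform (Adj G) f → ∀ v → card (f v) ≡ 1
  uniform⇒singletons uniform v = ≤-antisym
    (subst (card (f v) ≤_) (uniform v w v~w) (card≤card-⊕ (f v) (f w) (weakIASI⇒card≥1 G f f-weak w)))
    (weakIASI⇒card≥1 G f f-weak v)
    where
    w = proj₁ (noIsolated G v)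
    v~w = proj₂ (noIsolated G v)
  singletons⇒uniform : (∀ v → card (f v) ≡ 1) → IsOneUniform (Adj G) f
  singletons⇒uniform singletons u v _ = trans (card-⊕-singletonˡ (f u) (f v) (singletons u)) (singletons v)

∃-part-outside-which-all : ∀ {m} {k : Fin (suc m) → ℕ} (P : ∀ i → Fin (k i) → Set) →
  (∀ i v → Dec (P i v)) → (∀ i j u v → i ≢ j → P i u ⊎ P j v) →
  Σ (Fin (suc m)) λ i₀ → ∀ i → i ≢ i₀ → ∀ v → P i v
∃-part-outside-which-all P P? cross with any? (λ i → any? (λ v → ¬? (P? i v)))
... | yes (i₀ , u , ¬Pu) = i₀ , λ i i≢i₀ v →
        [ (λ Pu → contradiction Pu ¬Pu) , (λ Pv → Pv) ] (cross i₀ i u v (i≢i₀ ∘ sym))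
... | no noCounterexample = fzero , λ i _ v →
        decidable-stable (P? i v) λ ¬Pv → noCounterexample (i , v , ¬Pv)

mainTheorem10 : (n : ℕ) → 1 ≤ n → (G : Fin n → Graph) (f : JoinV G → FinSetℕ) →
    IsIASI (JoinAdj G) f →
    (∀ i → IsWeakIASI (Adj (G i)) (restrict G f i)) →
    IsWeakIASI (JoinAdj G) f ⇔
      Σ (Fin n) (λ i₀ → ∀ i → i ≢ i₀ → IsOneUniform (Adj (G i)) (restrict G f i))
mainTheorem10 n@(suc _) _ G f f-iasi parts-weak = mk⇔ weak⇒oneUniform oneUniform⇒weak
  where
  OneUniformOff : Fin n → Set
  OneUniformOff i₀ = ∀ i → i ≢ i₀ → IsOneUniform (Adj (G i)) (restrict G f i)
  partUniform⇔ : ∀ i → IsOneUniform (Adj (G i)) (restrict G f i) ⇔ (∀ v → card (f (i , v)) ≡ 1)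
  partUniform⇔ i = oneUniform⇔singletons (G i) (restrict G f i) (parts-weak i)
  edgeWeak⇔ : ∀ x y → card (f x ⊕ f y) ≡ card (f x) ⊔ card (f y) ⇔ (card (f x) ≡ 1 ⊎ card (f y) ≡ 1)
  edgeWeak⇔ (i , u) (j , v) = card-⊕≡⊔⇔singleton (f (i , u)) (f (j , v))
    (weakIASI⇒card≥1 (G i) (restrict G f i) (parts-weak i) u)
    (weakIASI⇒card≥1 (G j) (restrict G f j) (parts-weak j) v)

  weak⇒oneUniform : IsWeakIASI (JoinAdj G) f → Σ (Fin n) OneUniformOff
  weak⇒oneUniform (_ , weak) with ∃-part-outside-which-all (λ i v → card (f (i , v)) ≡ 1)
    (λ i v → card (f (i , v)) ≟ 1) (λ i j u v i≢j → to (edgeWeak⇔ _ _) (weak _ _ (inj₂ i≢j)))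
  ... | i₀ , singletonsOff = i₀ , λ i i≢i₀ → from (partUniform⇔ i) (singletonsOff i i≢i₀)

  oneUniform⇒weak : Σ (Fin n) OneUniformOff → IsWeakIASI (JoinAdj G) f
  oneUniform⇒weak (i₀ , uniform) = f-iasi , weak
    where
    singletonsOff : ∀ i → i ≢ i₀ → ∀ v → card (f (i , v)) ≡ 1
    singletonsOff i i≢i₀ = to (partUniform⇔ i) (uniform i i≢i₀)
    weak : IsWeak (JoinAdj G) f
    weak (i , u) (.i , v) (inj₁ (refl , u~v)) = proj₂ (parts-weak i) u v u~v
    weak (i , u) (j , v) (inj₂ i≢j) with i ≟ᶠ i₀
    ... | yes refl = from (edgeWeak⇔ _ _) (inj₂ (singletonsOff j (i≢j ∘ sym) v))
    ... | no i≢i₀  = from (edgeWeak⇔ _ _) (inj₁ (singletonsOff i i≢i₀ u))
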